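{- If a game $G$ is equivalent to $0$, then $G$ is identical to $0$.
   Context: A (finite impartial) game is defined recursively as a finite set of games, its options; $0$ is the game with no options. Games $G,H$ are identical iff every option of $G$ is identical to some option of $H$ and vice versa. Three players alternate moves cyclically; a move replaces the current game by one of its options, and the player who makes the last move wins. The disjunctive sum $G+H$ is the game whose options are all $G'+H$ and all $G+H'$. Types are defined recursively: $G$ is of type $\mathcal N$ iff it has some option of type $\mathcal P$; of type $\mathcal O$ iff it has at least one option and all its options are of type $\mathcal N$; of type $\mathcal P$ iff all its options are of type $\mathcal O$; of type $\mathcal Q$ otherwise. $G$ is equivalent to $H$ iff for every game $X$, $G+X$ and $H+X$ have the same type. -}

module Defs where

open import Data.List using (List; []; _∷_; _++_)
open import Data.Bool.ListAction using (any; all)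
open import Data.Bool using (Bool; true; false; if_then_else_; _∧_)
open import Data.List.Relation.Unary.All using (All)
open import Data.List.Relation.Unary.Any using (Any)
open import Relation.Binary.PropositionalEquality using (_≡_)

-- A finite impartial game, given by a finite list of options
-- (lists are read as finite sets up to identity `_≅_` below).
data Game : Set where
  mk : List Game → Game

zeroG : Game
zeroG = mk []

data _≅_ : Game → Game → Set where
  ident : ∀ {gs hs}
        → All (λ g → Any (λ h → g ≅ h) hs) gs
        → All (λ h → Any (λ g → g ≅ h) gs) hs
        → mk gs ≅ mk hs

mutual
  _⊕_ : Game → Game → Game
  mk gs ⊕ mk hs = mk (sumL gs hs ++ sumR gs hs)

  sumL : List Game → List Game → List Game
  sumL []       hs = []
  sumL (g ∷ gs) hs = (g ⊕ mk hs) ∷ sumL gs hs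

  sumR : List Game → List Game → List Game
  sumR gs []       = []
  sumR gs (h ∷ hs) = (mk gs ⊕ h) ∷ sumR gs hs

-- Outcome types for three-player games.
data Outcome : Set where
  𝒩 𝒪 𝒫 𝒬 : Outcome

isP? isN? isO? : Outcome → Bool
isP? 𝒫 = true
isP? _ = false
isN? 𝒩 = true
isN? _ = false
isO? 𝒪 = true
isO? _ = false

nonEmpty : List Outcome → Bool
nonEmpty []      = false
nonEmpty (_ ∷ _) = true

classify : List Outcome → Outcome
classify os =
  if any isP? os then 𝒩
  else if nonEmpty os ∧ all isN? os then 𝒪
  else if all isO? os then 𝒫
  else 𝒬

mutual
  type : Game → Outcome
  type (mk gs) = classify (types gs)

  types : List Game → List Outcome
  types []       = []
  types (g ∷ gs) = type g ∷ types gs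

_≈G_ : Game → Game → Set
G ≈G H = ∀ (X : Game) → type (G ⊕ X) ≡ type (H ⊕ X)

{-# OPTIONS --safe #-}
module Submission where

-- Let ⋆ = {0}, V = {0, ⋆} and W = {V}. Then 0 + W = W has type 𝒪, whereas
-- G + W has type 𝒬 for every G ≠ 0, so W separates every nonzero game from 0.
-- The latter holds by induction on G. The options of G + W are the G′ + W,
-- of type 𝒪 (G′ = 0) or 𝒬 (G′ ≠ 0), together with G + V. Hence G + W has no
-- 𝒫 option as soon as G + V is not 𝒫, which holds since G + V has the options
-- G + 0 and G + ⋆ and the latter has G + 0 as an option, so they are not both 𝒪.
-- G + W is not 𝒪 because its option G′ + W is not 𝒩; and it is not 𝒫: otherwise
-- every G′ is 0 and G + V is 𝒪, so G + ⋆ is 𝒩, yet none of its options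
-- 0 + ⋆ = ⋆ and G + 0 (which has the 𝒫 option 0) is 𝒫.

open import Defs
open import Data.Bool using (T; true; false; _∧_)
open import Data.Bool.ListAction using (any; all)
open import Data.Empty using (⊥-elim)
open import Data.List using (List; []; _∷_; _++_)
open import Data.List.Relation.Unary.All as All using (All; []; _∷_)
import Data.List.Relation.Unary.All.Properties as AllP
open import Data.List.Relation.Unary.Any as Any using (Any; here; there)
import Data.List.Relation.Unary.Any.Properties as AnyP
open import Data.Product as Product using (_×_; _,_)
open import Data.Sum as Sum using (_⊎_; inj₁; inj₂)
open import Function using (_∘_)
open import Relation.Binary.PropositionalEquality
  using (_≡_; _≢_; refl; sym; trans)

private
  variable
    o : Outcome
    gs : List Game

isP?⇒≡𝒫 : T (isP? o) → o ≡ 𝒫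
isP?⇒≡𝒫 {𝒫} _ = refl

isN?⇒≡𝒩 : T (isN? o) → o ≡ 𝒩
isN?⇒≡𝒩 {𝒩} _ = refl

isO?⇒≡𝒪 : T (isO? o) → o ≡ 𝒪
isO?⇒≡𝒪 {𝒪} _ = refl

𝒬-by-elimination : o ≢ 𝒩 → o ≢ 𝒪 → o ≢ 𝒫 → o ≡ 𝒬
𝒬-by-elimination {𝒩} ≢𝒩 _ _ = ⊥-elim (≢𝒩 refl)
𝒬-by-elimination {𝒪} _ ≢𝒪 _ = ⊥-elim (≢𝒪 refl)
𝒬-by-elimination {𝒫} _ _ ≢𝒫 = ⊥-elim (≢𝒫 refl)
𝒬-by-elimination {𝒬} _ _ _ = refl

classify≡𝒩⇒ : ∀ os → classify os ≡ 𝒩 → T (any isP? os)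
classify≡𝒩⇒ os eq with any isP? os | nonEmpty os ∧ all isN? os | all isO? os
classify≡𝒩⇒ os eq  | true  | _     | _     = _
classify≡𝒩⇒ os () | false | true  | _
classify≡𝒩⇒ os () | false | false | true
classify≡𝒩⇒ os () | false | false | false

classify≡𝒪⇒ : ∀ os → classify os ≡ 𝒪 → T (all isN? os)
classify≡𝒪⇒ os eq with any isP? os | nonEmpty os | all isN? os | all isO? os
classify≡𝒪⇒ os () | true  | _     | _     | _
classify≡𝒪⇒ os eq  | false | true  | true  | _     = _
classify≡𝒪⇒ os () | false | true  | false | true
classify≡𝒪⇒ os () | false | true  | false | false
classify≡𝒪⇒ os () | false | false | _     | true
classify≡𝒪⇒ os () | false | false | _     | false

classify≡𝒫⇒ : ∀ os → classify os ≡ 𝒫 → T (all isO? os)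
classify≡𝒫⇒ os eq with any isP? os | nonEmpty os ∧ all isN? os | all isO? os
classify≡𝒫⇒ os () | true  | _     | _
classify≡𝒫⇒ os () | false | true  | _
classify≡𝒫⇒ os eq  | false | false | true  = _
classify≡𝒫⇒ os () | false | false | false

module _ {P : Outcome → Set} where

  All-types⁻ : ∀ gs → All P (types gs) → All (P ∘ type) gs
  All-types⁻ []       []       = []
  All-types⁻ (g ∷ gs) (p ∷ ps) = p ∷ All-types⁻ gs ps

  Any-types⁻ : ∀ gs → Any P (types gs) → Any (P ∘ type) gs
  Any-types⁻ (g ∷ gs) (here p)  = here p
  Any-types⁻ (g ∷ gs) (there p) = there (Any-types⁻ gs p)

type≡𝒩⇒𝒫-option : type (mk gs) ≡ 𝒩 → Any (λ g → type g ≡ 𝒫) gs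
type≡𝒩⇒𝒫-option {gs} eq =
  Any.map isP?⇒≡𝒫
    (Any-types⁻ gs (AnyP.any⁻ isP? (types gs) (classify≡𝒩⇒ (types gs) eq)))

type≡𝒪⇒options-𝒩 : type (mk gs) ≡ 𝒪 → All (λ g → type g ≡ 𝒩) gs
type≡𝒪⇒options-𝒩 {gs} eq =
  All.map isN?⇒≡𝒩
    (All-types⁻ gs (AllP.all⁺ isN? (types gs) (classify≡𝒪⇒ (types gs) eq)))

type≡𝒫⇒options-𝒪 : type (mk gs) ≡ 𝒫 → All (λ g → type g ≡ 𝒪) gs
type≡𝒫⇒options-𝒪 {gs} eq =
  All.map isO?⇒≡𝒪
    (All-types⁻ gs (AllP.all⁺ isO? (types gs) (classify≡𝒫⇒ (types gs) eq)))

module _ {P : Game → Set} where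

  All-sumL⁻ : ∀ gs {hs} → All P (sumL gs hs) → All (λ g → P (g ⊕ mk hs)) gs
  All-sumL⁻ []       []       = []
  All-sumL⁻ (g ∷ gs) (p ∷ ps) = p ∷ All-sumL⁻ gs ps

  All-sumR⁻ : ∀ {gs} hs → All P (sumR gs hs) → All (λ h → P (mk gs ⊕ h)) hs
  All-sumR⁻ []       []       = []
  All-sumR⁻ (h ∷ hs) (p ∷ ps) = p ∷ All-sumR⁻ hs ps

  Any-sumL⁻ : ∀ gs {hs} → Any P (sumL gs hs) → Any (λ g → P (g ⊕ mk hs)) gs
  Any-sumL⁻ (g ∷ gs) (here p)  = here p
  Any-sumL⁻ (g ∷ gs) (there p) = there (Any-sumL⁻ gs p)

  Any-sumR⁻ : ∀ {gs} hs → Any P (sumR gs hs) → Any (λ h → P (mk gs ⊕ h)) hs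
  Any-sumR⁻ (h ∷ hs) (here p)  = here p
  Any-sumR⁻ (h ∷ hs) (there p) = there (Any-sumR⁻ hs p)

  All-options-⊕⁻ : ∀ gs hs → All P (sumL gs hs ++ sumR gs hs) →
                   All (λ g → P (g ⊕ mk hs)) gs × All (λ h → P (mk gs ⊕ h)) hs
  All-options-⊕⁻ gs hs =
    Product.map (All-sumL⁻ gs) (All-sumR⁻ hs) ∘ AllP.++⁻ (sumL gs hs)

  Any-options-⊕⁻ : ∀ gs hs → Any P (sumL gs hs ++ sumR gs hs) →
                   Any (λ g → P (g ⊕ mk hs)) gs ⊎ Any (λ h → P (mk gs ⊕ h)) hs
  Any-options-⊕⁻ gs hs =
    Sum.map (Any-sumL⁻ gs) (Any-sumR⁻ hs) ∘ AnyP.++⁻ (sumL gs hs)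

⋆ V W : Game
⋆ = mk (zeroG ∷ [])
V = mk (zeroG ∷ ⋆ ∷ [])
W = mk (V ∷ [])

⊕V≢𝒫 : ∀ G → type (G ⊕ V) ≢ 𝒫
⊕V≢𝒫 (mk gs) G+V≡𝒫
  with All-options-⊕⁻ gs (zeroG ∷ ⋆ ∷ []) (type≡𝒫⇒options-𝒪 G+V≡𝒫)
... | _ , G+0≡𝒪 ∷ G+⋆≡𝒪 ∷ []
  with All-options-⊕⁻ gs (zeroG ∷ []) (type≡𝒪⇒options-𝒩 G+⋆≡𝒪)
... | _ , G+0≡𝒩 ∷ [] with trans (sym G+0≡𝒪) G+0≡𝒩
... | ()

zero-options⊕V≢𝒪 : All (_≡ zeroG) gs → type (mk (zeroG ∷ gs) ⊕ V) ≢ 𝒪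
zero-options⊕V≢𝒪 {gs} gs≡0 G+V≡𝒪
  with All-options-⊕⁻ (zeroG ∷ gs) (zeroG ∷ ⋆ ∷ []) (type≡𝒪⇒options-𝒩 G+V≡𝒪)
... | _ , _ ∷ G+⋆≡𝒩 ∷ []
  with Any-options-⊕⁻ (zeroG ∷ gs) (zeroG ∷ []) (type≡𝒩⇒𝒫-option G+⋆≡𝒩)
... | inj₁ g+⋆≡𝒫 = AllP.All¬⇒¬Any (All.map (λ { refl () }) (refl ∷ gs≡0)) g+⋆≡𝒫
... | inj₂ (here G+0≡𝒫)
  with All-options-⊕⁻ (zeroG ∷ gs) [] (type≡𝒫⇒options-𝒪 G+0≡𝒫)
... | () ∷ _ , _

⊕W-outcome : Game → Outcome
⊕W-outcome (mk [])      = 𝒪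
⊕W-outcome (mk (_ ∷ _)) = 𝒬

⊕W-outcome≢𝒩 : ∀ G → ⊕W-outcome G ≢ 𝒩
⊕W-outcome≢𝒩 (mk [])      ()
⊕W-outcome≢𝒩 (mk (_ ∷ _)) ()

⊕W-outcome≢𝒫 : ∀ G → ⊕W-outcome G ≢ 𝒫
⊕W-outcome≢𝒫 (mk [])      ()
⊕W-outcome≢𝒫 (mk (_ ∷ _)) ()

⊕W-outcome≡𝒪⇒≡zeroG : ∀ G → ⊕W-outcome G ≡ 𝒪 → G ≡ zeroG
⊕W-outcome≡𝒪⇒≡zeroG (mk []) _ = refl

⊕W≡𝒬-from-options : ∀ g gs → All (λ h → type (h ⊕ W) ≡ ⊕W-outcome h) (g ∷ gs) →
                    type (mk (g ∷ gs) ⊕ W) ≡ 𝒬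
⊕W≡𝒬-from-options g gs options+W = 𝒬-by-elimination ≢𝒩 ≢𝒪 ≢𝒫
  where
    ≢𝒩 : type (mk (g ∷ gs) ⊕ W) ≢ 𝒩
    ≢𝒩 G+W≡𝒩 with Any-options-⊕⁻ (g ∷ gs) (V ∷ []) (type≡𝒩⇒𝒫-option G+W≡𝒩)
    ... | inj₁ g+W≡𝒫 =
      AllP.All¬⇒¬Any (All.map (λ {h} e → ⊕W-outcome≢𝒫 h ∘ trans (sym e)) options+W) g+W≡𝒫
    ... | inj₂ (here G+V≡𝒫) = ⊕V≢𝒫 (mk (g ∷ gs)) G+V≡𝒫

    ≢𝒪 : type (mk (g ∷ gs) ⊕ W) ≢ 𝒪
    ≢𝒪 G+W≡𝒪 with All-options-⊕⁻ (g ∷ gs) (V ∷ []) (type≡𝒪⇒options-𝒩 G+W≡𝒪)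
    ... | g+W≡𝒩 ∷ _ , _ = ⊕W-outcome≢𝒩 g (trans (sym (All.head options+W)) g+W≡𝒩)

    ≢𝒫 : type (mk (g ∷ gs) ⊕ W) ≢ 𝒫
    ≢𝒫 G+W≡𝒫 with All-options-⊕⁻ (g ∷ gs) (V ∷ []) (type≡𝒫⇒options-𝒪 G+W≡𝒫)
    ... | options+W≡𝒪 , G+V≡𝒪 ∷ []
      with All.zipWith (λ (e , e′) → ⊕W-outcome≡𝒪⇒≡zeroG _ (trans (sym e) e′))
                       (options+W , options+W≡𝒪)
    ... | refl ∷ gs≡0 = zero-options⊕V≢𝒪 gs≡0 G+V≡𝒪

mutual
  type-⊕W : ∀ G → type (G ⊕ W) ≡ ⊕W-outcome G
  type-⊕W (mk [])       = refl
  type-⊕W (mk (g ∷ gs)) = ⊕W≡𝒬-from-options g gs (types-⊕W (g ∷ gs))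

  types-⊕W : ∀ gs → All (λ g → type (g ⊕ W) ≡ ⊕W-outcome g) gs
  types-⊕W []       = []
  types-⊕W (g ∷ gs) = type-⊕W g ∷ types-⊕W gs

mainTheorem18 : (G : Game) → G ≈G zeroG → G ≅ zeroG
mainTheorem18 (mk [])       _    = ident [] []
mainTheorem18 (mk (g ∷ gs)) G≈0 with trans (sym (type-⊕W (mk (g ∷ gs)))) (G≈0 W)
... | ()
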